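{- For any integers $r\ge 2$ and $k\ge 2r$, the shadow graph $\partial TC^r_k$ is $K_{r+1}$-free.
   Context: The $r$-uniform tight cycle $TC^r_k$ ($k\ge r\ge 2$) has vertices $v_0,\dots,v_{k-1}$ and edges all $r$-sets of the form $\{v_i,v_{i+1},\dots,v_{i+r-1}\}$, indices modulo $k$. The shadow graph $\partial H$ of a hypergraph $H$ is the graph on $V(H)$ in which $xy$ is an edge iff some hyperedge of $H$ contains both $x$ and $y$. -}

module Defs where

open import Data.Nat using (ℕ; suc; _+_; _∸_; _<_; NonZero)
open import Data.Nat.DivMod using (_%_)
open import Data.Fin using (Fin; toℕ)
open import Data.Product using (∃-syntax; Σ-syntax; _×_)
open import Relation.Binary.PropositionalEquality using (_≡_)
open import Relation.Nullary using (¬_)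

-- Tight cycle TC^r_k on vertex set Fin k (vertex j is v_j).
-- Hyperedge number i (i : Fin k) is {v_i, v_{i+1}, ..., v_{i+r-1}} (indices mod k).
-- v lies in hyperedge i iff (v - i) mod k < r.
inTCEdge : (r k : ℕ) .{{_ : NonZero k}} → Fin k → Fin k → Set
inTCEdge r k i v = ((toℕ v + k ∸ toℕ i) % k) < r

shadowTC : (r k : ℕ) .{{_ : NonZero k}} → Fin k → Fin k → Set
shadowTC r k x y = ¬ (x ≡ y) × ∃[ i ] (inTCEdge r k i x × inTCEdge r k i y)

containsK : (m k : ℕ) → (Fin k → Fin k → Set) → Set
containsK m k E = Σ[ f ∈ (Fin m → Fin k) ] ((a b : Fin m) → ¬ (a ≡ b) → E (f a) (f b))

KFree : (m k : ℕ) → (Fin k → Fin k → Set) → Set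
KFree m k E = ¬ containsK m k E

{-# OPTIONS --safe #-}
-- Proof: measure positions on the cycle by forward offsets mod k.  A hyperedge is a window of
-- r consecutive offsets, so adjacent vertices are less than r apart in one of the two
-- directions.  Fix a vertex a of a putative K_{r+1}: every clique vertex lies less than r
-- ahead of a or less than r behind it.  Folding the positions behind a onto those ahead of it
-- leaves only r classes, so two clique vertices share a class; they are then either equal, or
-- r apart in one direction and k - r ≥ r apart in the other, hence not adjacent.
module Submission where

open import Defs
open import Data.Nat using (ℕ; suc; _+_; _*_; _∸_; _≤_; _<_; z≤n; s≤s; NonZero)
open import Data.Nat.Properties
open import Data.Nat.DivMod
open import Data.Fin as Fin using (Fin; toℕ; fromℕ<)
open import Data.Fin.Properties using (toℕ<n; toℕ-injective; fromℕ<-injective; pigeonhole)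
import Data.Fin.Properties as Finₚ
open import Data.Sum using (_⊎_; inj₁; inj₂)
open import Data.Product using (_,_; _×_; ∃₂; proj₁)
open import Data.Empty using (⊥)
open import Relation.Binary.PropositionalEquality
open import Relation.Nullary using (¬_)
open import Function using (_∘_)

module _ (k : ℕ) .{{_ : NonZero k}} where

  open ≡-Reasoning

  infix 4 _≈_
  _≈_ : ℕ → ℕ → Set
  m ≈ n = m % k ≡ n % k

  %-≈ : ∀ m → m % k ≈ m
  %-≈ m = m%n%n≡m%n m k

  ≈⇒≡ : ∀ {m n} → m < k → n < k → m ≈ n → m ≡ n
  ≈⇒≡ {m} {n} m<k n<k m≈n = begin
    m     ≡⟨ m<n⇒m%n≡m m<k ⟨
    m % k ≡⟨ m≈n ⟩
    n % k ≡⟨ m<n⇒m%n≡m n<k ⟩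
    n     ∎

  +-congˡ-≈ : ∀ o {m n} → m ≈ n → o + m ≈ o + n
  +-congˡ-≈ o {m} {n} m≈n = begin
    (o + m) % k             ≡⟨ %-distribˡ-+ o m k ⟩
    (o % k + m % k) % k     ≡⟨ cong (λ x → (o % k + x) % k) m≈n ⟩
    (o % k + n % k) % k     ≡⟨ %-distribˡ-+ o n k ⟨
    (o + n) % k             ∎

  +-congʳ-≈ : ∀ o {m n} → m ≈ n → m + o ≈ n + o
  +-congʳ-≈ o {m} {n} m≈n = begin
    (m + o) % k ≡⟨ cong (_% k) (+-comm m o) ⟩
    (o + m) % k ≡⟨ +-congˡ-≈ o m≈n ⟩
    (o + n) % k ≡⟨ cong (_% k) (+-comm o n) ⟩
    (n + o) % k ∎

  -- Adding k * o ∸ o undoes the addition of o.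
  +-cancelˡ-≈ : ∀ o {m n} → o + m ≈ o + n → m ≈ n
  +-cancelˡ-≈ o {m} {n} eq = begin
    m % k                       ≡⟨ undo m ⟨
    (k * o ∸ o + (o + m)) % k   ≡⟨ +-congˡ-≈ (k * o ∸ o) eq ⟩
    (k * o ∸ o + (o + n)) % k   ≡⟨ undo n ⟩
    n % k                       ∎
    where
    undo : ∀ x → k * o ∸ o + (o + x) ≈ x
    undo x = begin
      (k * o ∸ o + (o + x)) % k ≡⟨ cong (_% k) (+-assoc (k * o ∸ o) o x) ⟨
      (k * o ∸ o + o + x) % k   ≡⟨ cong (λ y → (y + x) % k) (m∸n+n≡m (m≤n*m o k)) ⟩
      (k * o + x) % k           ≡⟨ cong (_% k) (+-comm (k * o) x) ⟩
      (x + k * o) % k           ≡⟨ cong (λ y → (x + y) % k) (*-comm k o) ⟩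
      (x + o * k) % k           ≡⟨ [m+kn]%n≡m%n x o k ⟩
      x % k                     ∎

  -- inTCEdge r k i v unfolds to offset k i v < r.
  offset : Fin k → Fin k → ℕ
  offset i v = (toℕ v + k ∸ toℕ i) % k

  offset<k : ∀ i v → offset i v < k
  offset<k i v = m%n<n (toℕ v + k ∸ toℕ i) k

  offset-self : ∀ v → offset v v ≡ 0
  offset-self v = trans (cong (_% k) (m+n∸m≡n (toℕ v) k)) (n%n≡0 k)

  +-offset : ∀ i v → toℕ i + offset i v ≈ toℕ v
  +-offset i v = begin
    (toℕ i + offset i v) % k           ≡⟨ +-congˡ-≈ (toℕ i) (%-≈ (toℕ v + k ∸ toℕ i)) ⟩
    (toℕ i + (toℕ v + k ∸ toℕ i)) % k  ≡⟨ cong (_% k) (m+[n∸m]≡n i≤v+k) ⟩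
    (toℕ v + k) % k                    ≡⟨ [m+n]%n≡m%n (toℕ v) k ⟩
    toℕ v % k                          ∎
    where
    i≤v+k : toℕ i ≤ toℕ v + k
    i≤v+k = ≤-trans (<⇒≤ (toℕ<n i)) (m≤n+m k (toℕ v))

  offset-cocycle : ∀ i x y → offset i x + offset x y ≈ offset i y
  offset-cocycle i x y = +-cancelˡ-≈ (toℕ i) (begin
    (toℕ i + (offset i x + offset x y)) % k ≡⟨ cong (_% k) (+-assoc (toℕ i) _ _) ⟨
    (toℕ i + offset i x + offset x y) % k   ≡⟨ +-congʳ-≈ (offset x y) (+-offset i x) ⟩
    (toℕ x + offset x y) % k                ≡⟨ +-offset x y ⟩
    toℕ y % k                               ≡⟨ +-offset i y ⟨
    (toℕ i + offset i y) % k                ∎)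

  offset-determined : ∀ {d} i x y → d < k → offset i x + d ≈ offset i y → offset x y ≡ d
  offset-determined i x y d<k eq =
    ≈⇒≡ (offset<k x y) d<k (+-cancelˡ-≈ (offset i x) (trans (offset-cocycle i x y) (sym eq)))

  offset-flip : ∀ x y → 0 < offset x y → offset y x ≡ k ∸ offset x y
  offset-flip x y 0<xy = offset-determined x y x (∸-monoʳ-< 0<xy xy≤k) (begin
    (offset x y + (k ∸ offset x y)) % k ≡⟨ cong (_% k) (m+[n∸m]≡n xy≤k) ⟩
    k % k                               ≡⟨ n%n≡0 k ⟩
    0                                   ≡⟨ offset-self x ⟨
    offset x x                          ≡⟨ %-≈ (toℕ x + k ∸ toℕ x) ⟨
    offset x x % k                      ∎)
    where
    xy≤k : offset x y ≤ k
    xy≤k = <⇒≤ (offset<k x y)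

  offset-injective : ∀ i {x y} → offset i x ≡ offset i y → x ≡ y
  offset-injective i {x} {y} eq = toℕ-injective (≈⇒≡ (toℕ<n x) (toℕ<n y) (begin
    toℕ x % k                ≡⟨ +-offset i x ⟨
    (toℕ i + offset i x) % k ≡⟨ cong (λ d → (toℕ i + d) % k) eq ⟩
    (toℕ i + offset i y) % k ≡⟨ +-offset i y ⟩
    toℕ y % k                ∎))

fold : ∀ {r s o} → o < s + r → o < r ⊎ s < o → Fin r
fold o<s+r (inj₁ o<r) = fromℕ< o<r
fold {r} {s} {o} o<s+r (inj₂ s<o) = fromℕ< (o∸s<r o<s+r s<o)
  where
  o∸s<r : o < s + r → s < o → o ∸ s < r
  o∸s<r o<s+r s<o = subst (o ∸ s <_) (m+n∸m≡n s r) (∸-monoˡ-< o<s+r (<⇒≤ s<o))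

fold-collision : ∀ {r s o o′} (o<s+r : o < s + r) (o′<s+r : o′ < s + r)
                 (p : o < r ⊎ s < o) (p′ : o′ < r ⊎ s < o′) →
                 fold o<s+r p ≡ fold o′<s+r p′ → o ≡ o′ ⊎ o + s ≡ o′ ⊎ o′ + s ≡ o
fold-collision _ _ (inj₁ o<r) (inj₁ o′<r) eq = inj₁ (fromℕ<-injective _ _ o<r o′<r eq)
fold-collision _ _ (inj₂ s<o) (inj₂ s<o′) eq =
  inj₁ (∸-cancelʳ-≡ (<⇒≤ s<o) (<⇒≤ s<o′) (fromℕ<-injective _ _ _ _ eq))
fold-collision _ _ (inj₁ o<r) (inj₂ s<o′) eq =
  inj₂ (inj₁ (trans (cong (_+ _) (fromℕ<-injective _ _ _ _ eq)) (m∸n+n≡m (<⇒≤ s<o′))))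
fold-collision _ _ (inj₂ s<o) (inj₁ o′<r) eq =
  inj₂ (inj₂ (trans (cong (_+ _) (fromℕ<-injective _ _ _ _ (sym eq))) (m∸n+n≡m (<⇒≤ s<o))))

Near : (r k : ℕ) .{{_ : NonZero k}} → Fin k → Fin k → Set
Near r k x y = offset k x y < r ⊎ offset k y x < r

module _ {r k : ℕ} .{{_ : NonZero k}} where

  offset-within-window : ∀ i {x y} → offset k i x ≤ offset k i y → offset k i y < r → offset k x y < r
  offset-within-window i {x} {y} ix≤iy iy<r = begin-strict
    offset k x y                  ≡⟨ offset-determined k i x y d<k (cong (_% k) (m+[n∸m]≡n ix≤iy)) ⟩
    offset k i y ∸ offset k i x   ≤⟨ m∸n≤m (offset k i y) (offset k i x) ⟩
    offset k i y                  <⟨ iy<r ⟩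
    r                             ∎
    where
    open ≤-Reasoning
    d<k : offset k i y ∸ offset k i x < k
    d<k = ≤-<-trans (m∸n≤m (offset k i y) (offset k i x)) (offset<k k i y)

  shadow⇒Near : ∀ {x y} → shadowTC r k x y → Near r k x y
  shadow⇒Near {x} {y} (_ , i , x∈i , y∈i) with ≤-total (offset k i x) (offset k i y)
  ... | inj₁ ix≤iy = inj₁ (offset-within-window i ix≤iy y∈i)
  ... | inj₂ iy≤ix = inj₂ (offset-within-window i iy≤ix x∈i)

  Near⇒ahead⊎behind : ∀ a v → r ≤ k → Near r k a v → offset k a v < r ⊎ k ∸ r < offset k a v
  Near⇒ahead⊎behind _ _ r≤k (inj₁ av<r) = inj₁ av<r
  Near⇒ahead⊎behind a v r≤k (inj₂ va<r) with m≤n⇒m<n∨m≡n (z≤n {offset k v a})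
  ... | inj₁ 0<va = inj₂ (subst (k ∸ r <_) (sym (offset-flip k v a 0<va)) (∸-monoʳ-< va<r r≤k))
  ... | inj₂ 0≡va = inj₁ (subst (λ w → offset k a w < r) a≡v (subst (_< r) (sym (offset-self k a)) 0<r))
    where
    a≡v : a ≡ v
    a≡v = offset-injective k v (trans (sym 0≡va) (sym (offset-self k v)))
    0<r : 0 < r
    0<r = ≤-<-trans z≤n va<r

  far-apart : ∀ a {x y} → r + r ≤ k → offset k a x + (k ∸ r) ≡ offset k a y → ¬ Near r k x y
  far-apart a {x} {y} 2r≤k ax+k∸r≡ay (inj₁ xy<r) =
    <-irrefl refl (<-≤-trans (subst (_< r) xy≡k∸r xy<r) (m+n≤o⇒m≤o∸n r 2r≤k))
    where
    xy≡k∸r : offset k x y ≡ k ∸ r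
    xy≡k∸r = offset-determined k a x y (∸-monoʳ-< (≤-<-trans z≤n xy<r) (≤-trans (m≤m+n r r) 2r≤k))
                                       (cong (_% k) ax+k∸r≡ay)
  far-apart a {x} {y} 2r≤k ax+k∸r≡ay (inj₂ yx<r) = <-irrefl refl (subst (_< r) yx≡r yx<r)
    where
    open ≡-Reasoning
    r≤k : r ≤ k
    r≤k = ≤-trans (m≤m+n r r) 2r≤k
    ay+r≈ax : (offset k a y + r) % k ≡ offset k a x % k
    ay+r≈ax = begin
      (offset k a y + r) % k               ≡⟨ cong (λ d → (d + r) % k) ax+k∸r≡ay ⟨
      (offset k a x + (k ∸ r) + r) % k     ≡⟨ cong (_% k) (+-assoc (offset k a x) (k ∸ r) r) ⟩
      (offset k a x + (k ∸ r + r)) % k     ≡⟨ cong (λ d → (offset k a x + d) % k) (m∸n+n≡m r≤k) ⟩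
      (offset k a x + k) % k               ≡⟨ [m+n]%n≡m%n (offset k a x) k ⟩
      offset k a x % k                     ∎
    yx≡r : offset k y x ≡ r
    yx≡r = offset-determined k a y x (<-≤-trans (m<m+n r (≤-<-trans z≤n yx<r)) 2r≤k) ay+r≈ax

lemma2p6 : (r k : ℕ) → 2 ≤ r → r + r ≤ k → .{{_ : NonZero k}} →
             KFree (suc r) k (shadowTC r k)
lemma2p6 r k 2≤r 2r≤k (f , adj) = collide (pigeonhole (n<1+n r) (λ b → fold (bound b) (side b)))
  where
  a : Fin k
  a = f Fin.zero
  r≤k : r ≤ k
  r≤k = ≤-trans (m≤m+n r r) 2r≤k
  bound : ∀ b → offset k a (f b) < k ∸ r + r
  bound b = subst (offset k a (f b) <_) (sym (m∸n+n≡m r≤k)) (offset<k k a (f b))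
  side : ∀ b → offset k a (f b) < r ⊎ k ∸ r < offset k a (f b)
  side Fin.zero = inj₁ (subst (_< r) (sym (offset-self k a)) (≤-trans (s≤s z≤n) 2≤r))
  side (Fin.suc b) = Near⇒ahead⊎behind a (f (Fin.suc b)) r≤k (shadow⇒Near (adj Fin.zero (Fin.suc b) λ ()))
  collide : ∃₂ (λ b b′ → b Fin.< b′ × fold (bound b) (side b) ≡ fold (bound b′) (side b′)) → ⊥
  collide (b , b′ , b<b′ , same) with fold-collision (bound b) (bound b′) (side b) (side b′) same
  ... | inj₁ eq = proj₁ (adj b b′ (Finₚ.<⇒≢ b<b′)) (offset-injective k a eq)
  ... | inj₂ (inj₁ eq) = far-apart a 2r≤k eq (shadow⇒Near (adj b b′ (Finₚ.<⇒≢ b<b′)))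
  ... | inj₂ (inj₂ eq) = far-apart a 2r≤k eq (shadow⇒Near (adj b′ b (Finₚ.<⇒≢ b<b′ ∘ sym)))
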